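{- Let $R$ be a rack. Then the following statements are equivalent: (1) $\mathcal{R}(R)$ is a Boolean algebra; (2) $\mathcal{R}(R)$ is distributive; (3) $\mathcal{R}(R)$ is pseudocomplemented; (4) $\mathcal{R}(R)$ is uniquely complemented.
   Context: A rack is a set $R$ with a binary operation $\triangleright$ such that $a\triangleright(b\triangleright c)=(a\triangleright b)\triangleright(a\triangleright c)$ for all $a,b,c\in R$, and for all $a,b\in R$ there is a unique $x\in R$ with $a\triangleright x=b$. A subrack is a subset $Q$ with $(Q,\triangleright)$ a rack (including $\emptyset$); $\ll S\gg$ is the intersection of all subracks containing $S$. $\mathcal{R}(R)$ is the lattice of subracks ordered by inclusion, with meet the intersection, join $\ll Q\cup Q'\gg$, bottom $\emptyset$ and top $R$. A Boolean algebra is a complemented distributive lattice. A lattice with least element $\hat 0$ is pseudocomplemented if for every $x$ there is a greatest element $x^*$ with $x\wedge x^*=\hat 0$. A lattice is uniquely complemented if it is complemented and every element has exactly one complement. -}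

module Defs where

open import Level using (Level; _⊔_; suc; Lift; lift)
open import Data.Product using (Σ; ∃; ∃-syntax; _×_; _,_)
open import Data.Empty using (⊥)
open import Data.Unit using (⊤; tt)
open import Relation.Unary using (Pred; _∈_; _⊆_)
open import Relation.Binary.PropositionalEquality using (_≡_; refl; sym; trans)

record Rack (ℓ : Level) : Set (suc ℓ) where
  infixr 6 _▷_
  field
    Carrier  : Set ℓ
    _▷_      : Carrier → Carrier → Carrier
    selfDist : ∀ a b c → a ▷ (b ▷ c) ≡ (a ▷ b) ▷ (a ▷ c)
    uniqueSol : ∀ a b → Σ Carrier λ x → (a ▷ x ≡ b) × (∀ y → a ▷ y ≡ b → x ≡ y)

module LatticeNotions {a ℓ : Level} (S : Set a) (_≤_ : S → S → Set ℓ) (⊥' ⊤' : S) where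

  _≈_ : S → S → Set ℓ
  x ≈ y = (x ≤ y) × (y ≤ x)

  IsMeet : S → S → S → Set (a ⊔ ℓ)
  IsMeet x y m = (m ≤ x) × (m ≤ y) × (∀ c → c ≤ x → c ≤ y → c ≤ m)

  IsJoin : S → S → S → Set (a ⊔ ℓ)
  IsJoin x y j = (x ≤ j) × (y ≤ j) × (∀ c → x ≤ c → y ≤ c → j ≤ c)

  Distributive : Set (a ⊔ ℓ)
  Distributive = ∀ x y z j m₁ m₂ m₃ k →
    IsJoin y z j → IsMeet x j m₁ → IsMeet x y m₂ → IsMeet x z m₃ →
    IsJoin m₂ m₃ k → m₁ ≈ k

  MeetIsBot : S → S → Set (a ⊔ ℓ)
  MeetIsBot x y = ∀ m → IsMeet x y m → m ≈ ⊥'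

  JoinIsTop : S → S → Set (a ⊔ ℓ)
  JoinIsTop x y = ∀ j → IsJoin x y j → j ≈ ⊤'

  IsComplement : S → S → Set (a ⊔ ℓ)
  IsComplement x y = MeetIsBot x y × JoinIsTop x y

  Complemented : Set (a ⊔ ℓ)
  Complemented = ∀ x → Σ S λ y → IsComplement x y

  BooleanAlgebra : Set (a ⊔ ℓ)
  BooleanAlgebra = Complemented × Distributive

  Pseudocomplemented : Set (a ⊔ ℓ)
  Pseudocomplemented = ∀ x → Σ S λ x* → MeetIsBot x x* × (∀ y → MeetIsBot x y → y ≤ x*)

  UniquelyComplemented : Set (a ⊔ ℓ)
  UniquelyComplemented =
    Complemented × (∀ x y z → IsComplement x y → IsComplement x z → y ≈ z)

module _ {ℓ : Level} (R : Rack ℓ) where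
  open Rack R

  -- (Q, ▷) is a rack: closed under ▷ and unique solvability inside Q.
  -- (Self-distributivity is inherited from R.)
  IsSubrack : Pred Carrier ℓ → Set ℓ
  IsSubrack Q =
    (∀ {a b} → a ∈ Q → b ∈ Q → (a ▷ b) ∈ Q) ×
    (∀ {a b} → a ∈ Q → b ∈ Q →
       Σ Carrier λ x → x ∈ Q × (a ▷ x ≡ b) × (∀ y → y ∈ Q → a ▷ y ≡ b → x ≡ y))

  record Subrack : Set (suc ℓ) where
    constructor subrack
    field
      pred      : Pred Carrier ℓ
      isSubrack : IsSubrack pred

  open Subrack

  _≤ₛ_ : Subrack → Subrack → Set ℓ
  Q ≤ₛ Q' = pred Q ⊆ pred Q'

  ∅ₛ : Subrack
  ∅ₛ = subrack (λ _ → Lift ℓ ⊥) ((λ { () }) , (λ { () }))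

  Rₛ : Subrack
  Rₛ = subrack (λ _ → Lift ℓ ⊤)
    ((λ _ _ → lift tt) ,
     (λ {a} {b} _ _ → let (x , e , u) = uniqueSol a b in
        x , lift tt , e , (λ y _ ey → u y ey)))

  module ℛ = LatticeNotions Subrack _≤ₛ_ ∅ₛ Rₛ

module Submission where

-- Write ≪x≫ for the subrack generated by a single element x.  Every element
-- of ≪x≫ acts on R exactly as x does, so ≪x≫ is just the closure of {x}
-- under x ▷ _ and x ▷⁻¹ _, and two such subracks are either disjoint or
-- nested.  The whole theorem turns on the condition
--     OrbitInvariant :  a ▷ b ∈ ≪b≫  for all a, b ∈ R,
-- which says that every subrack is stable under the action of all of R.
--   * If R is orbit-invariant, unions and set complements of subracks are
--     subracks; hence ℛ(R) is the lattice of stable subsets and is Boolean,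
--     pseudocomplemented and uniquely complemented (complements need
--     excluded middle).
--   * Conversely, if a ▷ b ∉ ≪b≫ then ≪a ▷ b≫ is disjoint from ≪a≫ and from
--     ≪b≫ but lies below ≪a≫ ∨ ≪b≫; this contradicts distributivity and
--     pseudocomplementedness.  For unique complements, translating a
--     complement C of Q by any q ∈ Q gives another complement, so C is
--     stable under Q, Q ∪ C is a subrack, and Q ∪ C = R forces a ▷ b ∈ ≪b≫.
-- Since Boolean algebras are distributive, the four conditions agree.

open import Defs
open import Level using (Level; suc; lift; lower)
open import Data.Product using (_×_; _,_; proj₁; proj₂)
open import Data.Sum using (_⊎_; inj₁; inj₂)
open import Data.Empty using (⊥-elim)
open import Data.Unit using (tt)
open import Relation.Nullary using (¬_; Dec; yes; no)
open import Relation.Nullary.Decidable using (map′; decidable-stable)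
open import Relation.Unary using (Pred; _⊆_; _∪_; _∩_; ∁)
open import Relation.Binary.PropositionalEquality
  using (_≡_; refl; sym; trans; cong; cong₂; subst; module ≡-Reasoning)
open import Function.Bundles using (_⇔_; mk⇔)
open import Axiom.ExcludedMiddle using (ExcludedMiddle)

module Symmetry {a ℓ : Level} (S : Set a) (_≤_ : S → S → Set ℓ) (⊥' ⊤' : S) where
  open LatticeNotions S _≤_ ⊥' ⊤'

  meet-sym : ∀ x y m → IsMeet x y m → IsMeet y x m
  meet-sym x y m (m≤x , m≤y , greatest) = m≤y , m≤x , λ c c≤y c≤x → greatest c c≤x c≤y

  join-sym : ∀ x y j → IsJoin x y j → IsJoin y x j
  join-sym x y j (x≤j , y≤j , least) = y≤j , x≤j , λ c y≤c x≤c → least c x≤c y≤c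

  complement-sym : ∀ x y → IsComplement x y → IsComplement y x
  complement-sym x y (meet⊥ , join⊤) =
    (λ m isMeet → meet⊥ m (meet-sym y x m isMeet)) ,
    (λ j isJoin → join⊤ j (join-sym y x j isJoin))

module RackTheory {ℓ : Level} (R : Rack ℓ) where
  open Rack R
  open Subrack {R = R}
  open ℛ R
  open Symmetry (Subrack R) (_≤ₛ_ R) (∅ₛ R) (Rₛ R) using (complement-sym)
  open ≡-Reasoning

  Sub : Set (suc ℓ)
  Sub = Subrack R

  _≤_ : Sub → Sub → Set ℓ
  _≤_ = _≤ₛ_ R

  infixr 6 _▷⁻¹_
  _▷⁻¹_ : Carrier → Carrier → Carrier
  a ▷⁻¹ b = proj₁ (uniqueSol a b)

  ▷-▷⁻¹ : ∀ a b → a ▷ (a ▷⁻¹ b) ≡ b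
  ▷-▷⁻¹ a b = proj₁ (proj₂ (uniqueSol a b))

  ▷⁻¹-unique : ∀ {a b y} → a ▷ y ≡ b → a ▷⁻¹ b ≡ y
  ▷⁻¹-unique {a} {b} {y} = proj₂ (proj₂ (uniqueSol a b)) y

  ▷⁻¹-▷ : ∀ a y → a ▷⁻¹ (a ▷ y) ≡ y
  ▷⁻¹-▷ a y = ▷⁻¹-unique refl

  ▷-cancel : ∀ a {y z} → a ▷ y ≡ a ▷ z → y ≡ z
  ▷-cancel a {y} {z} e = trans (sym (▷⁻¹-▷ a y)) (trans (cong (a ▷⁻¹_) e) (▷⁻¹-▷ a z))

  IsHom : (Carrier → Carrier) → Set ℓ
  IsHom f = ∀ x y → f (x ▷ y) ≡ f x ▷ f y

  hom-▷⁻¹ : ∀ {f} → IsHom f → ∀ x y → f (x ▷⁻¹ y) ≡ f x ▷⁻¹ f y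
  hom-▷⁻¹ {f} hom x y = sym (▷⁻¹-unique (trans (sym (hom x (x ▷⁻¹ y))) (cong f (▷-▷⁻¹ x y))))

  ▷-hom : ∀ q → IsHom (q ▷_)
  ▷-hom = selfDist

  ▷⁻¹-hom : ∀ q → IsHom (q ▷⁻¹_)
  ▷⁻¹-hom q e f = ▷⁻¹-unique (begin
    q ▷ ((q ▷⁻¹ e) ▷ (q ▷⁻¹ f))       ≡⟨ selfDist q _ _ ⟩
    (q ▷ (q ▷⁻¹ e)) ▷ (q ▷ (q ▷⁻¹ f)) ≡⟨ cong₂ _▷_ (▷-▷⁻¹ q e) (▷-▷⁻¹ q f) ⟩
    e ▷ f                               ∎)

  _∈ₛ_ : Carrier → Sub → Set ℓ
  e ∈ₛ Q = pred Q e

  ▷-closed : ∀ Q {a b} → a ∈ₛ Q → b ∈ₛ Q → (a ▷ b) ∈ₛ Q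
  ▷-closed Q = proj₁ (isSubrack Q)

  -- The solution inside Q is the solution in R, so subracks are closed under ▷⁻¹.
  ▷⁻¹-closed : ∀ Q {a b} → a ∈ₛ Q → b ∈ₛ Q → (a ▷⁻¹ b) ∈ₛ Q
  ▷⁻¹-closed Q pa pb with proj₂ (isSubrack Q) pa pb
  ... | x , px , ax≡b , _ = subst (pred Q) (sym (▷⁻¹-unique ax≡b)) px

  subrackOf : (P : Pred Carrier ℓ) →
              (∀ {a b} → P a → P b → P (a ▷ b)) →
              (∀ {a b} → P a → P b → P (a ▷⁻¹ b)) → Sub
  subrackOf P ▷-cl ▷⁻¹-cl = subrack P (▷-cl , λ {a} {b} pa pb →
    a ▷⁻¹ b , ▷⁻¹-cl pa pb , ▷-▷⁻¹ a b , λ _ _ ay≡b → ▷⁻¹-unique ay≡b)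

  preimage : (f : Carrier → Carrier) → IsHom f → Sub → Sub
  preimage f hom Q = subrackOf (λ e → f e ∈ₛ Q)
    (λ {a} {b} pa pb → subst (pred Q) (sym (hom a b)) (▷-closed Q pa pb))
    (λ {a} {b} pa pb → subst (pred Q) (sym (hom-▷⁻¹ hom a b)) (▷⁻¹-closed Q pa pb))

  _∩ₛ_ : Sub → Sub → Sub
  Q ∩ₛ Q' = subrackOf (pred Q ∩ pred Q')
    (λ (p , p') (q , q') → ▷-closed Q p q , ▷-closed Q' p' q')
    (λ (p , p') (q , q') → ▷⁻¹-closed Q p q , ▷⁻¹-closed Q' p' q')

  ∩-meet : ∀ Q Q' → IsMeet Q Q' (Q ∩ₛ Q')
  ∩-meet Q Q' = proj₁ , proj₂ , λ _ c≤Q c≤Q' p → c≤Q p , c≤Q' p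

  data Generated (P : Pred Carrier ℓ) : Pred Carrier ℓ where
    gen     : ∀ {x} → P x → Generated P x
    gen-▷   : ∀ {x y} → Generated P x → Generated P y → Generated P (x ▷ y)
    gen-▷⁻¹ : ∀ {x y} → Generated P x → Generated P y → Generated P (x ▷⁻¹ y)

  generated-least : ∀ {P} Q → P ⊆ pred Q → Generated P ⊆ pred Q
  generated-least Q P⊆Q (gen p)       = P⊆Q p
  generated-least Q P⊆Q (gen-▷ g h)   = ▷-closed Q (generated-least Q P⊆Q g) (generated-least Q P⊆Q h)
  generated-least Q P⊆Q (gen-▷⁻¹ g h) = ▷⁻¹-closed Q (generated-least Q P⊆Q g) (generated-least Q P⊆Q h)

  _∨ₛ_ : Sub → Sub → Sub
  Q ∨ₛ Q' = subrackOf (Generated (pred Q ∪ pred Q')) gen-▷ gen-▷⁻¹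

  ∨-join : ∀ Q Q' → IsJoin Q Q' (Q ∨ₛ Q')
  ∨-join Q Q' = (λ p → gen (inj₁ p)) , (λ p → gen (inj₂ p)) , λ c Q≤c Q'≤c →
    generated-least c λ { (inj₁ p) → Q≤c p ; (inj₂ p) → Q'≤c p }

  disjoint⇒meet⊥ : ∀ Q Q' → (∀ {e} → e ∈ₛ Q → ¬ e ∈ₛ Q') → MeetIsBot Q Q'
  disjoint⇒meet⊥ Q Q' disjoint m (m≤Q , m≤Q' , _) =
    (λ p → ⊥-elim (disjoint (m≤Q p) (m≤Q' p))) , λ ()

  meet⊥⇒disjoint : ∀ Q Q' → MeetIsBot Q Q' → ∀ {e} → e ∈ₛ Q → ¬ e ∈ₛ Q'
  meet⊥⇒disjoint Q Q' meet⊥ p q = lower (proj₁ (meet⊥ (Q ∩ₛ Q') (∩-meet Q Q')) (p , q))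

  -- Orbit x is the subrack ≪x≫ generated by x; it suffices to close {x}
  -- under x ▷ _ and x ▷⁻¹ _ because all its elements act as x does.
  data Orbit (x : Carrier) : Pred Carrier ℓ where
    here     : Orbit x x
    ▷-step   : ∀ {y} → Orbit x y → Orbit x (x ▷ y)
    ▷⁻¹-step : ∀ {y} → Orbit x y → Orbit x (x ▷⁻¹ y)

  orbit-acts-as : ∀ {x y} → Orbit x y → ∀ z → y ▷ z ≡ x ▷ z
  orbit-acts-as here z = refl
  orbit-acts-as {x} (▷-step {y} p) z = begin
    (x ▷ y) ▷ z                   ≡⟨ cong ((x ▷ y) ▷_) (sym (▷-▷⁻¹ x z)) ⟩
    (x ▷ y) ▷ (x ▷ (x ▷⁻¹ z))     ≡⟨ sym (selfDist x y (x ▷⁻¹ z)) ⟩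
    x ▷ (y ▷ (x ▷⁻¹ z))           ≡⟨ cong (x ▷_) (orbit-acts-as p (x ▷⁻¹ z)) ⟩
    x ▷ (x ▷ (x ▷⁻¹ z))           ≡⟨ cong (x ▷_) (▷-▷⁻¹ x z) ⟩
    x ▷ z                         ∎
  orbit-acts-as {x} (▷⁻¹-step {y} p) z = ▷-cancel x (begin
    x ▷ ((x ▷⁻¹ y) ▷ z)           ≡⟨ selfDist x (x ▷⁻¹ y) z ⟩
    (x ▷ (x ▷⁻¹ y)) ▷ (x ▷ z)     ≡⟨ cong (_▷ (x ▷ z)) (▷-▷⁻¹ x y) ⟩
    y ▷ (x ▷ z)                   ≡⟨ orbit-acts-as p (x ▷ z) ⟩
    x ▷ (x ▷ z)                   ∎)

  same-action⇒same-division : ∀ {u x} → (∀ z → u ▷ z ≡ x ▷ z) → ∀ b → u ▷⁻¹ b ≡ x ▷⁻¹ b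
  same-action⇒same-division {u} {x} same b = ▷⁻¹-unique (trans (same (x ▷⁻¹ b)) (▷-▷⁻¹ x b))

  -- ≪x≫ is closed under ▷ and ▷⁻¹ because its elements act as x.
  orbitₛ : Carrier → Sub
  orbitₛ x = subrackOf (Orbit x)
    (λ {a} {b} pa pb → subst (Orbit x) (sym (orbit-acts-as pa b)) (▷-step pb))
    (λ {a} {b} pa pb → subst (Orbit x) (sym (same-action⇒same-division (orbit-acts-as pa) b)) (▷⁻¹-step pb))

  orbit-least : ∀ x Q → x ∈ₛ Q → Orbit x ⊆ pred Q
  orbit-least x Q x∈Q here         = x∈Q
  orbit-least x Q x∈Q (▷-step p)   = ▷-closed Q x∈Q (orbit-least x Q x∈Q p)
  orbit-least x Q x∈Q (▷⁻¹-step p) = ▷⁻¹-closed Q x∈Q (orbit-least x Q x∈Q p)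

  -- y ∈ ≪x≫ implies x ∈ ≪y≫: the last step of a path to y can be undone.
  orbit-sym : ∀ {x y} → Orbit x y → Orbit y x
  orbit-sym here = here
  orbit-sym {x} (▷-step {y} p) = orbit-least y (orbitₛ (x ▷ y)) y∈ (orbit-sym p)
    where
    y∈ : Orbit (x ▷ y) y
    y∈ = subst (Orbit (x ▷ y))
           (trans (same-action⇒same-division (orbit-acts-as (▷-step p)) (x ▷ y)) (▷⁻¹-▷ x y))
           (▷⁻¹-step here)
  orbit-sym {x} (▷⁻¹-step {y} p) = orbit-least y (orbitₛ (x ▷⁻¹ y)) y∈ (orbit-sym p)
    where
    y∈ : Orbit (x ▷⁻¹ y) y
    y∈ = subst (Orbit (x ▷⁻¹ y))
           (trans (orbit-acts-as (▷⁻¹-step p) (x ▷⁻¹ y)) (▷-▷⁻¹ x y))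
           (▷-step here)

  orbit-overlap : ∀ {x y e} → Orbit x e → Orbit y e → Orbit x y
  orbit-overlap {x} {e = e} x~e y~e = orbit-least e (orbitₛ x) x~e (orbit-sym y~e)

  -- If ≪a ▷ b≫ meets ≪a≫, then a acts as a ▷ b, hence
  -- b = a ▷⁻¹ (a ▷ b) = (a ▷ b) ▷⁻¹ (a ▷ b) ∈ ≪a ▷ b≫.
  orbit-overlap-left : ∀ {a b e} → Orbit (a ▷ b) e → Orbit a e → Orbit b (a ▷ b)
  orbit-overlap-left {a} {b} ab~e a~e = orbit-sym (subst (Orbit (a ▷ b)) b≡ (▷⁻¹-step here))
    where
    b≡ : (a ▷ b) ▷⁻¹ (a ▷ b) ≡ b
    b≡ = trans (sym (same-action⇒same-division (orbit-acts-as (orbit-overlap ab~e a~e)) (a ▷ b)))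
               (▷⁻¹-▷ a b)

  OrbitInvariant : Set ℓ
  OrbitInvariant = ∀ a b → Orbit b (a ▷ b)

  Stable : Pred Carrier ℓ → Set ℓ
  Stable P = (∀ a {b} → P b → P (a ▷ b)) × (∀ a {b} → P b → P (a ▷⁻¹ b))

  stableₛ : (P : Pred Carrier ℓ) → Stable P → Sub
  stableₛ P (▷-st , ▷⁻¹-st) = subrackOf P (λ {a} _ → ▷-st a) (λ {a} _ → ▷⁻¹-st a)

  stable-∪ : ∀ {P P'} → Stable P → Stable P' → Stable (P ∪ P')
  stable-∪ (▷-st , ▷⁻¹-st) (▷-st' , ▷⁻¹-st') =
    (λ { a (inj₁ p) → inj₁ (▷-st a p)   ; a (inj₂ p) → inj₂ (▷-st' a p) }) ,
    (λ { a (inj₁ p) → inj₁ (▷⁻¹-st a p) ; a (inj₂ p) → inj₂ (▷⁻¹-st' a p) })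

  -- Because a ▷ _ is a bijection with inverse a ▷⁻¹ _, complements stay stable.
  stable-∁ : ∀ {P} → Stable P → Stable (∁ P)
  stable-∁ {P} (▷-st , ▷⁻¹-st) =
    (λ a {b} ¬pb p → ¬pb (subst P (▷⁻¹-▷ a b) (▷⁻¹-st a p))) ,
    (λ a {b} ¬pb p → ¬pb (subst P (▷-▷⁻¹ a b) (▷-st a p)))

  invariant⇒stable : OrbitInvariant → ∀ Q → Stable (pred Q)
  invariant⇒stable invariant Q =
    (λ a {b} b∈Q → orbit-least b Q b∈Q (invariant a b)) ,
    (λ a {b} b∈Q → orbit-least b Q b∈Q (orbit-sym (b∈≪a▷⁻¹b≫ a b)))
    where
    b∈≪a▷⁻¹b≫ : ∀ a b → Orbit (a ▷⁻¹ b) b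
    b∈≪a▷⁻¹b≫ a b = subst (Orbit (a ▷⁻¹ b)) (▷-▷⁻¹ a b) (invariant a (a ▷⁻¹ b))

  module _ (invariant : OrbitInvariant) where
    _∪ₛ_ : Sub → Sub → Sub
    Q ∪ₛ Q' = stableₛ (pred Q ∪ pred Q') (stable-∪ (invariant⇒stable invariant Q) (invariant⇒stable invariant Q'))

    ∪-join : ∀ Q Q' → IsJoin Q Q' (Q ∪ₛ Q')
    ∪-join Q Q' = inj₁ , inj₂ , λ _ Q≤c Q'≤c → λ { (inj₁ p) → Q≤c p ; (inj₂ p) → Q'≤c p }

    ∁ₛ : Sub → Sub
    ∁ₛ Q = stableₛ (∁ (pred Q)) (stable-∁ (invariant⇒stable invariant Q))

    ∁-meet⊥ : ∀ Q → MeetIsBot Q (∁ₛ Q)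
    ∁-meet⊥ Q = disjoint⇒meet⊥ Q (∁ₛ Q) λ p ¬p → ¬p p

    -- Every join lies inside the union, which gives x ∧ (y ∨ z) ≤ (x ∧ y) ∨ (x ∧ z);
    -- the reverse inequality holds in every lattice.
    invariant⇒distributive : Distributive
    invariant⇒distributive x y z j m₁ m₂ m₃ k
        (y≤j , z≤j , j-least) (m₁≤x , m₁≤j , m₁-greatest)
        (m₂≤x , m₂≤y , m₂-greatest) (m₃≤x , m₃≤z , m₃-greatest) (m₂≤k , m₃≤k , k-least) =
      m₁≤k , k≤m₁
      where
      m₁≤k : m₁ ≤ k
      m₁≤k p with j-least (y ∪ₛ z) inj₁ inj₂ (m₁≤j p)
      ... | inj₁ p∈y = m₂≤k (m₂-greatest (x ∩ₛ y) proj₁ proj₂ (m₁≤x p , p∈y))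
      ... | inj₂ p∈z = m₃≤k (m₃-greatest (x ∩ₛ z) proj₁ proj₂ (m₁≤x p , p∈z))
      k≤m₁ : k ≤ m₁
      k≤m₁ = k-least m₁ (m₁-greatest m₂ m₂≤x (λ p → y≤j (m₂≤y p)))
                        (m₁-greatest m₃ m₃≤x (λ p → z≤j (m₃≤z p)))

    -- A complement y of x lies inside any other complement z, because
    -- x ∪ z is a join of x and z, hence all of R, while x ∩ y = ∅.
    complement-below : ∀ x y z → IsComplement x y → IsComplement x z → y ≤ z
    complement-below x y z (meet⊥ , _) (_ , join⊤) {e} e∈y
      with proj₂ (join⊤ (x ∪ₛ z) (∪-join x z)) {e} (lift tt)
    ... | inj₁ e∈x = ⊥-elim (meet⊥⇒disjoint x y meet⊥ e∈x e∈y)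
    ... | inj₂ e∈z = e∈z

    invariant⇒pseudocomplemented : Pseudocomplemented
    invariant⇒pseudocomplemented Q =
      ∁ₛ Q , ∁-meet⊥ Q , λ Q' meet⊥ p∈Q' p∈Q → meet⊥⇒disjoint Q Q' meet⊥ p∈Q p∈Q'

  -- The translate q ▷ C = { q ▷ c | c ∈ C }, i.e. the preimage of C under q ▷⁻¹ _.
  translate : Carrier → Sub → Sub
  translate q C = preimage (q ▷⁻¹_) (▷⁻¹-hom q) C

  translate-complement : ∀ Q C {q} → q ∈ₛ Q → IsComplement Q C → IsComplement Q (translate q C)
  translate-complement Q C {q} q∈Q (meet⊥ , join⊤) =
    disjoint⇒meet⊥ Q qC (λ p∈Q p∈qC → meet⊥⇒disjoint Q C meet⊥ (▷⁻¹-closed Q q∈Q p∈Q) p∈qC) ,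
    qC-join⊤
    where
    qC : Sub
    qC = translate q C
    -- An upper bound j of Q and q ▷ C contains q ▷ e for all e ∈ Q ∨ C = R.
    qC-join⊤ : JoinIsTop Q qC
    qC-join⊤ j (Q≤j , qC≤j , _) = (λ _ → lift tt) , λ {e} _ →
      subst (pred j) (▷-▷⁻¹ q e) (Q∨C≤q⁻¹j (proj₂ (join⊤ (Q ∨ₛ C) (∨-join Q C)) (lift tt)))
      where
      Q∨C≤q⁻¹j : (Q ∨ₛ C) ≤ preimage (q ▷_) (▷-hom q) j
      Q∨C≤q⁻¹j = proj₂ (proj₂ (∨-join Q C)) (preimage (q ▷_) (▷-hom q) j)
        (λ p∈Q → Q≤j (▷-closed Q q∈Q p∈Q))
        (λ {c} c∈C → qC≤j (subst (pred C) (sym (▷⁻¹-▷ q c)) c∈C))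

  -- With unique complements, a complement C of Q is stable under Q, so
  -- Q ∪ C is a subrack; as Q ∨ C = R, every element lies in Q or in C.
  module _ (unique : ∀ x y z → IsComplement x y → IsComplement x z → y ≈ z) where
    complement-▷ : ∀ Q C → IsComplement Q C → ∀ {q c} → q ∈ₛ Q → c ∈ₛ C → (q ▷ c) ∈ₛ C
    complement-▷ Q C comp {q} {c} q∈Q c∈C =
      proj₂ (unique Q C (translate q C) comp (translate-complement Q C q∈Q comp)) (subst (pred C) (sym (▷⁻¹-▷ q c)) c∈C)

    complement-▷⁻¹ : ∀ Q C → IsComplement Q C → ∀ {q c} → q ∈ₛ Q → c ∈ₛ C → (q ▷⁻¹ c) ∈ₛ C
    complement-▷⁻¹ Q C comp {q} q∈Q = proj₁ (unique Q C (translate q C) comp (translate-complement Q C q∈Q comp))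

    complement-cover : ∀ Q C → IsComplement Q C → ∀ e → e ∈ₛ Q ⊎ e ∈ₛ C
    complement-cover Q C comp e =
      generated-least Q∪C (λ p → p) (proj₂ (proj₂ comp (Q ∨ₛ C) (∨-join Q C)) {e} (lift tt))
      where
      comp' : IsComplement C Q
      comp' = complement-sym Q C comp
      Q∪C : Sub
      Q∪C = subrackOf (pred Q ∪ pred C)
        (λ { (inj₁ p) (inj₁ q) → inj₁ (▷-closed Q p q)
           ; (inj₁ p) (inj₂ q) → inj₂ (complement-▷ Q C comp p q)
           ; (inj₂ p) (inj₁ q) → inj₁ (complement-▷ C Q comp' p q)
           ; (inj₂ p) (inj₂ q) → inj₂ (▷-closed C p q) })
        (λ { (inj₁ p) (inj₁ q) → inj₁ (▷⁻¹-closed Q p q)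
           ; (inj₁ p) (inj₂ q) → inj₂ (complement-▷⁻¹ Q C comp p q)
           ; (inj₂ p) (inj₁ q) → inj₁ (complement-▷⁻¹ C Q comp' p q)
           ; (inj₂ p) (inj₂ q) → inj₂ (▷⁻¹-closed C p q) })

  -- Split a by a complement C of ≪b≫: if a ∈ ≪b≫ then a ▷ b = b ▷ b,
  -- and if a ∈ C then a ▷ b ∈ ≪b≫ by stability of ≪b≫ under C.
  uniquelyComplemented⇒invariant : UniquelyComplemented → OrbitInvariant
  uniquelyComplemented⇒invariant (complemented , unique) a b
    with complemented (orbitₛ b)
  ... | C , comp with complement-cover unique (orbitₛ b) C comp a
  ...   | inj₁ a∈≪b≫ = subst (Orbit b) (sym (orbit-acts-as a∈≪b≫ b)) (▷-step here)
  ...   | inj₂ a∈C   = complement-▷ unique C (orbitₛ b) (complement-sym (orbitₛ b) C comp) a∈C here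

  separated-left : ∀ {a b} → ¬ Orbit b (a ▷ b) → MeetIsBot (orbitₛ (a ▷ b)) (orbitₛ a)
  separated-left {a} {b} ¬inv = disjoint⇒meet⊥ (orbitₛ (a ▷ b)) (orbitₛ a) λ ab~e a~e → ¬inv (orbit-overlap-left ab~e a~e)

  separated-right : ∀ {a b} → ¬ Orbit b (a ▷ b) → MeetIsBot (orbitₛ (a ▷ b)) (orbitₛ b)
  separated-right {a} {b} ¬inv = disjoint⇒meet⊥ (orbitₛ (a ▷ b)) (orbitₛ b) λ ab~e b~e → ¬inv (orbit-overlap b~e ab~e)

  -- Distributivity would give ≪a▷b≫ = ≪a▷b≫ ∧ (≪a≫ ∨ ≪b≫) = ∅ ∨ ∅ = ∅.
  distributive⇒¬¬invariant : Distributive → ∀ a b → ¬ ¬ Orbit b (a ▷ b)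
  distributive⇒¬¬invariant distributive a b ¬inv =
    lower (proj₁ X∧[A∨B]≈∅ (here , gen-▷ (gen (inj₁ here)) (gen (inj₂ here))))
    where
    X A B : Sub
    X = orbitₛ (a ▷ b)
    A = orbitₛ a
    B = orbitₛ b
    ∅-join : IsJoin (X ∩ₛ A) (X ∩ₛ B) (∅ₛ R)
    ∅-join = (λ (p , q) → ⊥-elim (meet⊥⇒disjoint X A (separated-left ¬inv) p q)) ,
             (λ (p , q) → ⊥-elim (meet⊥⇒disjoint X B (separated-right ¬inv) p q)) ,
             λ _ _ _ ()
    X∧[A∨B]≈∅ : (X ∩ₛ (A ∨ₛ B)) ≈ ∅ₛ R
    X∧[A∨B]≈∅ = distributive X A B (A ∨ₛ B) (X ∩ₛ (A ∨ₛ B)) (X ∩ₛ A) (X ∩ₛ B) (∅ₛ R)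
      (∨-join A B) (∩-meet X (A ∨ₛ B)) (∩-meet X A) (∩-meet X B) ∅-join

  -- The pseudocomplement of ≪a▷b≫ would contain a and b, hence a ▷ b.
  pseudocomplemented⇒¬¬invariant : Pseudocomplemented → ∀ a b → ¬ ¬ Orbit b (a ▷ b)
  pseudocomplemented⇒¬¬invariant pseudo a b ¬inv with pseudo (orbitₛ (a ▷ b))
  ... | X* , meet⊥ , greatest = meet⊥⇒disjoint (orbitₛ (a ▷ b)) X* meet⊥ here (▷-closed X* a∈X* b∈X*)
    where
    a∈X* : a ∈ₛ X*
    a∈X* = greatest (orbitₛ a) (separated-left ¬inv) here
    b∈X* : b ∈ₛ X*
    b∈X* = greatest (orbitₛ b) (separated-right ¬inv) here

  -- Excluded middle is needed to see that set complements are lattice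
  -- complements and to remove the double negations above.
  module Classical (em : ExcludedMiddle (suc ℓ)) where
    -- Excluded middle at level suc ℓ decides propositions of level ℓ.
    decide : (P : Set ℓ) → Dec P
    decide P = map′ lower lift em

    ¬¬invariant⇒invariant : (∀ a b → ¬ ¬ Orbit b (a ▷ b)) → OrbitInvariant
    ¬¬invariant⇒invariant ¬¬inv a b = decidable-stable (decide _) (¬¬inv a b)

    distributive⇒invariant : Distributive → OrbitInvariant
    distributive⇒invariant distributive = ¬¬invariant⇒invariant (distributive⇒¬¬invariant distributive)

    pseudocomplemented⇒invariant : Pseudocomplemented → OrbitInvariant
    pseudocomplemented⇒invariant pseudo = ¬¬invariant⇒invariant (pseudocomplemented⇒¬¬invariant pseudo)

    invariant⇒complemented : OrbitInvariant → Complemented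
    invariant⇒complemented invariant Q = ∁ₛ invariant Q , ∁-meet⊥ invariant Q , join⊤
      where
      join⊤ : JoinIsTop Q (∁ₛ invariant Q)
      join⊤ j (Q≤j , ∁Q≤j , _) = (λ _ → lift tt) , λ {e} _ → in-j e
        where
        in-j : ∀ e → e ∈ₛ j
        in-j e with decide (e ∈ₛ Q)
        ... | yes e∈Q = Q≤j e∈Q
        ... | no  e∉Q = ∁Q≤j e∉Q

    invariant⇒boolean : OrbitInvariant → BooleanAlgebra
    invariant⇒boolean invariant = invariant⇒complemented invariant , invariant⇒distributive invariant

    invariant⇒uniquelyComplemented : OrbitInvariant → UniquelyComplemented
    invariant⇒uniquelyComplemented invariant = invariant⇒complemented invariant ,
      λ x y z x⊥y x⊥z → complement-below invariant x y z x⊥y x⊥z , complement-below invariant x z y x⊥z x⊥y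

theorem5p5 : {ℓ : Level} → ExcludedMiddle (suc ℓ) → (R : Rack ℓ) →
    (ℛ.BooleanAlgebra R ⇔ ℛ.Distributive R)
    × (ℛ.BooleanAlgebra R ⇔ ℛ.Pseudocomplemented R)
    × (ℛ.BooleanAlgebra R ⇔ ℛ.UniquelyComplemented R)
theorem5p5 em R =
    mk⇔ proj₂
        (λ distributive → invariant⇒boolean (distributive⇒invariant distributive))
  , mk⇔ (λ boolean → invariant⇒pseudocomplemented (distributive⇒invariant (proj₂ boolean)))
        (λ pseudo → invariant⇒boolean (pseudocomplemented⇒invariant pseudo))
  , mk⇔ (λ boolean → invariant⇒uniquelyComplemented (distributive⇒invariant (proj₂ boolean)))
        (λ unique → invariant⇒boolean (uniquelyComplemented⇒invariant unique))
  where
  open RackTheory R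
  open Classical em
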